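{- For every $i\in\{2,\dots,m\}$, $X_1^*\cup X_2^*\cup\dots\cup X_i^*\subseteq Y_1\cup Y_2\cup\dots\cup Y_{i-1}$.
   Context: Fix an instance of ROLDARP: a complete undirected graph with positive edge weights (travel times), an origin, a time limit $T$, an integer $f$ with $1<f<T$ and all edge weights at most $T/f$, and requests $(s,d,t,p)$ (source, destination, release time, revenue) revealed online at their release times; a unit-capacity non-preemptive server starting at the origin at time $0$ serves a request by travelling to $s$ and then to $d$, leaving $s$ no earlier than $t$, and earns $p$ if it completes by time $T$. Each request is served at most once. $\mathrm{OPT}$ is an optimal offline schedule. Time is split into segments $t_1,\dots,t_f$ of length $T/f$ ($t_j$ ends at $jT/f$), and window $i$ consists of segments $t_{2i-1},t_{2i}$. Algorithm SBP: if $f$ is odd it idles during $t_1$ and sets $i=2$, else $i=1$; while $i<f$, at the start of $t_i$ it computes, among released unserved requests, a maximum-total-revenue sequence of requests servable consecutively within time $T/f$ starting at the source of the first, moves to that source during $t_i$ and serves the sequence during $t_{i+1}$ (idling if no request is available), then increases $i$ by $2$. Let $m=\lceil f/2\rceil-1$. For $i=1,\dots,m$: $S'_i$ is the set of requests that SBP serves in window $i+1$; $S_i^*$ is the set of requests that $\mathrm{OPT}$ completes during whichever of $t_{2i-1},t_{2i}$ has larger $\mathrm{OPT}$ revenue. Define $X_i^*=\{r\in S_i^*: r\in S'_w \text{ for some } w\in\{1,\dots,i-1\}\}$ and $Y_i=\{r\in S'_i: r\notin S_w^* \text{ for all } w\in\{1,\dots,i\}\}$.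
   Formalization: The travel times, the time limit $T$, the release times and revenues of requests, and the times at which OPT leaves each source are all rational. -}

module Defs where

open import Data.Nat as ℕ using (ℕ; zero; suc; _∸_; _%_)
open import Data.Integer using (+_)
open import Data.Rational using (ℚ; 0ℚ; _+_; _*_; _≤_; _<_; _/_)
open import Data.Rational.Properties using (_≤?_; _<?_)
open import Data.Fin using (Fin)
open import Data.List using (List; []; _∷_; map; filter; foldr)
open import Data.List.Relation.Unary.All using (All)
open import Data.List.Relation.Unary.Unique.Propositional using (Unique)
open import Data.List.Membership.Propositional using (_∈_; _∉_)
open import Data.Product using (Σ; ∃; ∃-syntax; _×_; _,_; proj₁; proj₂)
open import Data.Sum using (_⊎_)
open import Data.Unit using (⊤)
open import Relation.Nullary using (¬_; Dec)
open import Relation.Nullary.Decidable using (_×-dec_)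
open import Relation.Binary.PropositionalEquality using (_≡_)

ℚ[_] : ℕ → ℚ
ℚ[ k ] = + k / 1

-- A ROLDARP instance (all times / revenues rational).
-- Vertices: Fin V (complete graph, edge weight w u v).
-- Requests: indexed by Fin n; request r = (src r, dst r, rel r, rev r).

record Instance : Set where
  field
    V      : ℕ
    w      : Fin V → Fin V → ℚ
    origin : Fin V
    T      : ℚ
    f      : ℕ
    n      : ℕ
    src    : Fin n → Fin V
    dst    : Fin n → Fin V
    rel    : Fin n → ℚ
    rev    : Fin n → ℚ

-- Standing assumptions of the paper.  (T/f conditions are multiplied by f.)
record WellFormed (I : Instance) : Set where
  open Instance I
  field
    w-sym   : ∀ u v → w u v ≡ w v u
    w-self  : ∀ u → w u u ≡ 0ℚ
    w-pos   : ∀ u v → ¬ (u ≡ v) → 0ℚ < w u v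
    w-bound : ∀ u v → ℚ[ f ] * w u v ≤ T
    f>1     : 1 ℕ.< f
    f<T     : ℚ[ f ] < T
    rel≥0   : ∀ r → 0ℚ ≤ rel r

module _ (I : Instance) where
  open Instance I

  len : Fin n → ℚ
  len r = w (src r) (dst r)

  revenue : List (Fin n) → ℚ
  revenue = foldr (λ r acc → rev r + acc) 0ℚ

  -- Offline schedules: list of (request, time the server leaves its source).
  -- The request is completed at  d + len r.

  completion : Fin n × ℚ → ℚ
  completion (r , d) = d + len r

  -- server at vertex p, free from time τ
  FeasibleFrom : Fin V → ℚ → List (Fin n × ℚ) → Set
  FeasibleFrom p τ [] = ⊤
  FeasibleFrom p τ ((r , d) ∷ σ) =
    rel r ≤ d × τ + w p (src r) ≤ d × d + len r ≤ T
    × FeasibleFrom (dst r) (d + len r) σ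

  Feasible : List (Fin n × ℚ) → Set
  Feasible σ = Unique (map proj₁ σ) × FeasibleFrom origin 0ℚ σ

  schedRevenue : List (Fin n × ℚ) → ℚ
  schedRevenue σ = revenue (map proj₁ σ)

  IsOPT : List (Fin n × ℚ) → Set
  IsOPT σ = Feasible σ × (∀ σ' → Feasible σ' → schedRevenue σ' ≤ schedRevenue σ)

  -- Segments: t_j = ((j-1)T/f , jT/f]  (conditions multiplied by f).

  InSeg : ℕ → ℚ → Set
  InSeg j c = ℚ[ j ∸ 1 ] * T < ℚ[ f ] * c × ℚ[ f ] * c ≤ ℚ[ j ] * T

  inSeg? : ∀ j c → Dec (InSeg j c)
  inSeg? j c = (ℚ[ j ∸ 1 ] * T <? ℚ[ f ] * c) ×-dec (ℚ[ f ] * c ≤? ℚ[ j ] * T)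

  segRevenue : List (Fin n × ℚ) → ℕ → ℚ
  segRevenue σ j = schedRevenue (filter (λ x → inSeg? j (completion x)) σ)

  m : ℕ
  m = (f ℕ.+ 1) ℕ./ 2 ∸ 1      -- ⌈f/2⌉ - 1

  ValidChoice : List (Fin n × ℚ) → (ℕ → ℕ) → Set
  ValidChoice σ choice = ∀ i → 1 ℕ.≤ i → i ℕ.≤ m →
      (choice i ≡ 2 ℕ.* i ∸ 1 × segRevenue σ (2 ℕ.* i) ≤ segRevenue σ (2 ℕ.* i ∸ 1))
    ⊎ (choice i ≡ 2 ℕ.* i × segRevenue σ (2 ℕ.* i ∸ 1) ≤ segRevenue σ (2 ℕ.* i))

  Sstar : List (Fin n × ℚ) → (ℕ → ℕ) → ℕ → Fin n → Set
  Sstar σ choice i r = ∃[ d ] ((r , d) ∈ σ × InSeg (choice i) (completion (r , d)))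

  -- Algorithm SBP.  Iteration k = 0,1,… : moves during segment moveSeg k,
  -- serves during segment moveSeg k + 1; runs while moveSeg k < f.

  moveSeg : ℕ → ℕ
  moveSeg k = 1 ℕ.+ f % 2 ℕ.+ 2 ℕ.* k

  servTime : List (Fin n) → ℚ
  servTime [] = 0ℚ
  servTime (r ∷ []) = len r
  servTime (r ∷ r' ∷ rs) = len r + w (dst r) (src r') + servTime (r' ∷ rs)

  Candidate : (ℕ → List (Fin n)) → ℕ → List (Fin n) → Set
  Candidate run k ρ =
    Unique ρ
    × All (λ r → ℚ[ f ] * rel r ≤ ℚ[ moveSeg k ∸ 1 ] * T) ρ   -- released at start of t_{moveSeg k}
    × All (λ r → ∀ k' → k' ℕ.< k → r ∉ run k') ρ
    × ℚ[ f ] * servTime ρ ≤ T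

  -- run k = sequence served by SBP in iteration k (any maximiser)
  IsSBPRun : (ℕ → List (Fin n)) → Set
  IsSBPRun run = ∀ k → moveSeg k ℕ.< f →
    Candidate run k (run k) × (∀ ρ → Candidate run k ρ → revenue ρ ≤ revenue (run k))

  -- S'_i : requests SBP serves in window i+1 (segments t_{2i+1}, t_{2i+2})
  Sprime : (ℕ → List (Fin n)) → ℕ → Fin n → Set
  Sprime run i r = ∃[ k ] (moveSeg k ℕ.< f
    × (suc (moveSeg k) ≡ 2 ℕ.* i ℕ.+ 1 ⊎ suc (moveSeg k) ≡ 2 ℕ.* i ℕ.+ 2)
    × r ∈ run k)

  Xstar : List (Fin n × ℚ) → (ℕ → ℕ) → (ℕ → List (Fin n)) → ℕ → Fin n → Set
  Xstar σ choice run i r =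
    Sstar σ choice i r × ∃[ v ] (1 ℕ.≤ v × v ℕ.≤ i ∸ 1 × Sprime run v r)

  Y : List (Fin n × ℚ) → (ℕ → ℕ) → (ℕ → List (Fin n)) → ℕ → Fin n → Set
  Y σ choice run i r =
    Sprime run i r × (∀ v → 1 ℕ.≤ v → v ℕ.≤ i → ¬ Sstar σ choice v r)

module Submission where

-- Lemma 5 is a statement about the offline optimum only: the requests that
-- OPT completes in the chosen segments t_{choice 1}, t_{choice 2}, … form
-- pairwise disjoint sets S*_1, S*_2, ….  Indeed OPT serves every request at most once, so a
-- request has a single completion time; the segments are disjoint
-- half-open intervals; and the chosen segments strictly increase with the
-- window index, since choice i ∈ {2i-1, 2i}.  Hence a request of X*_j that
-- SBP served in window v+1 (v < j) lies in no S*_w with w ≤ v < j, i.e. it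
-- belongs to Y_v.

open import Defs
open import Data.Nat using (ℕ; _≤_; _<_; _∸_; _*_; suc; z≤n; s≤s; >-nonZero)
import Data.Nat.Properties as ℕ
open import Data.Nat.Coprimality as Coprime using (1-coprimeTo)
open import Data.Fin using (Fin)
open import Data.Integer as ℤ using (+_; +≤+)
open import Data.Integer.Properties using (*-identityʳ)
open import Data.List using (List; _∷_; map)
open import Data.List.Membership.Propositional using (_∈_)
open import Data.List.Membership.Propositional.Properties using (∈-map⁺)
open import Data.List.Relation.Unary.Any using (here; there)
open import Data.List.Relation.Unary.AllPairs using (_∷_)
open import Data.List.Relation.Unary.Unique.Propositional using (Unique)
open import Data.List.Relation.Unary.Unique.Propositional.Properties
  using (Unique[x∷xs]⇒x∉xs)
open import Data.Product using (_×_; _,_; proj₁; proj₂; ∃-syntax)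
open import Data.Rational as ℚ using (ℚ; 0ℚ; *≤*)
import Data.Rational.Properties as ℚₚ
open import Data.Sum using (_⊎_; inj₁; inj₂)
open import Data.Empty using (⊥; ⊥-elim)
open import Relation.Binary.PropositionalEquality using (_≡_; refl; sym; subst; subst₂)

-- In an association list whose keys are pairwise distinct, a key determines
-- its value.  Applied to OPT, whose requests are unique: a request has one
-- departure time, hence one completion time.
unique-keys⇒same-value : ∀ {A B : Set} {a : A} {b b′ : B} (xs : List (A × B)) →
  Unique (map proj₁ xs) → (a , b) ∈ xs → (a , b′) ∈ xs → b ≡ b′
unique-keys⇒same-value (_ ∷ _)  _           (here refl) (here refl) = refl
unique-keys⇒same-value (_ ∷ xs) u           (here refl) (there m′)  =
  ⊥-elim (Unique[x∷xs]⇒x∉xs u (∈-map⁺ proj₁ m′))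
unique-keys⇒same-value (_ ∷ xs) u           (there m)   (here refl) =
  ⊥-elim (Unique[x∷xs]⇒x∉xs u (∈-map⁺ proj₁ m))
unique-keys⇒same-value (_ ∷ xs) (_ ∷ u)     (there m)   (there m′)  =
  unique-keys⇒same-value xs u m m′

ℚ[]-mono-≤ : ∀ {a b} → a ≤ b → ℚ[ a ] ℚ.≤ ℚ[ b ]
ℚ[]-mono-≤ {a} {b} a≤b
  rewrite ℚₚ.normalize-coprime {a} {0} (Coprime.sym (1-coprimeTo a))
        | ℚₚ.normalize-coprime {b} {0} (Coprime.sym (1-coprimeTo b)) =
  *≤* (subst₂ ℤ._≤_ (sym (*-identityʳ (+ a))) (sym (*-identityʳ (+ b))) (+≤+ a≤b))

between-pred-and-self : ∀ {c k} {A B : Set} → (c ≡ k ∸ 1 × A) ⊎ (c ≡ k × B) →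
  k ∸ 1 ≤ c × c ≤ k
between-pred-and-self {k = k} (inj₁ (refl , _)) = ℕ.≤-refl , ℕ.m∸n≤m k 1
between-pred-and-self {k = k} (inj₂ (refl , _)) = ℕ.m∸n≤m k 1 , ℕ.≤-refl

module _ (I : Instance) where
  open Instance I

  horizon-nonNeg : WellFormed I → 0ℚ ℚ.≤ T
  horizon-nonNeg wf = ℚₚ.≤-trans (ℚ[]-mono-≤ {0} {f} z≤n) (ℚₚ.<⇒≤ (WellFormed.f<T wf))

  -- Distinct segments are disjoint: t_j lies entirely before t_k when j < k,
  -- because the right end jT/f of t_j is at most the left end (k-1)T/f of t_k.
  segments-disjoint : 0ℚ ℚ.≤ T → ∀ {j k c} → j < k → InSeg I j c → InSeg I k c → ⊥
  segments-disjoint T≥0 {j} {k} {c} j<k (_ , c≤j) (k-1<c , _) =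
    ℚₚ.<-irrefl refl (ℚₚ.<-≤-trans k-1<c (ℚₚ.≤-trans c≤j jT≤[k-1]T))
    where
    jT≤[k-1]T : ℚ[ j ] ℚ.* T ℚ.≤ ℚ[ k ∸ 1 ] ℚ.* T
    jT≤[k-1]T = ℚₚ.*-monoʳ-≤-nonNeg T {{ℚ.nonNegative T≥0}} (ℚ[]-mono-≤ (ℕ.<⇒≤pred j<k))

  module _ (σ : List (Fin n × ℚ)) (choice : ℕ → ℕ) where

    choice-in-window : ValidChoice I σ choice → ∀ {i} → 1 ≤ i → i ≤ m I →
      2 * i ∸ 1 ≤ choice i × choice i ≤ 2 * i
    choice-in-window valid {i} 1≤i i≤m = between-pred-and-self (valid i 1≤i i≤m)

    -- Hence the chosen segments strictly increase with the window index:
    -- choice w ≤ 2w < 2w+1 ≤ 2j-1 ≤ choice j whenever w < j.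
    choice-increasing : ValidChoice I σ choice → ∀ {w j} → 1 ≤ w → w < j → j ≤ m I →
      choice w < choice j
    choice-increasing valid {w} {j} 1≤w w<j j≤m =
      ℕ.≤-trans (s≤s (proj₂ (choice-in-window valid 1≤w w≤m))) 2w+1≤2j-1
      where
      w≤m : w ≤ m I
      w≤m = ℕ.≤-trans (ℕ.<⇒≤ w<j) j≤m
      2w+1≤2j-1 : suc (2 * w) ≤ choice j
      2w+1≤2j-1 = ℕ.≤-trans
        (ℕ.∸-monoˡ-≤ 1 (ℕ.≤-trans (ℕ.≤-reflexive (sym (ℕ.*-suc 2 w))) (ℕ.*-monoʳ-≤ 2 w<j)))
        (proj₁ (choice-in-window valid (ℕ.≤-trans 1≤w (ℕ.<⇒≤ w<j)) j≤m))

    Sstar-disjoint : 0ℚ ℚ.≤ T → Feasible I σ → ValidChoice I σ choice →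
      ∀ {w j r} → 1 ≤ w → w < j → j ≤ m I →
      Sstar I σ choice w r → Sstar I σ choice j r → ⊥
    Sstar-disjoint T≥0 (unique , _) valid {w} {j} {r} 1≤w w<j j≤m
      (d , r∈σ , in-w) (d′ , r∈σ′ , in-j) =
      segments-disjoint T≥0 (choice-increasing valid 1≤w w<j j≤m) in-w′ in-j
      where
      in-w′ : InSeg I (choice w) (completion I (r , d′))
      in-w′ = subst (λ t → InSeg I (choice w) (completion I (r , t)))
                    (unique-keys⇒same-value σ unique r∈σ r∈σ′) in-w

lemma5 : (I : Instance) → WellFormed I
    → (σ : List (Fin (Instance.n I) × ℚ)) → IsOPT I σ
    → (choice : ℕ → ℕ) → ValidChoice I σ choice
    → (run : ℕ → List (Fin (Instance.n I))) → IsSBPRun I run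
    → ∀ i → 2 ≤ i → i ≤ m I
    → ∀ (r : Fin (Instance.n I))
    → ∃[ j ] (1 ≤ j × j ≤ i × Xstar I σ choice run j r)
    → ∃[ k ] (1 ≤ k × k ≤ i ∸ 1 × Y I σ choice run k r)
lemma5 I wf σ (feasible , _) choice valid run _ i _ i≤m r
  (j , 1≤j , j≤i , r∈S*j , v , 1≤v , v≤j-1 , r∈S′v) =
  v , 1≤v , ℕ.≤-trans v≤j-1 (ℕ.∸-monoˡ-≤ 1 j≤i) , r∈S′v , not-in-earlier-S*
  where
  not-in-earlier-S* : ∀ w → 1 ≤ w → w ≤ v → Sstar I σ choice w r → ⊥
  not-in-earlier-S* w 1≤w w≤v r∈S*w =
    Sstar-disjoint I σ choice (horizon-nonNeg I wf) feasible valid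
      1≤w w<j (ℕ.≤-trans j≤i i≤m) r∈S*w r∈S*j
    where
    w<j : w < j
    w<j = ℕ.m≤pred[n]⇒suc[m]≤n {{>-nonZero 1≤j}} (ℕ.≤-trans w≤v v≤j-1)
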